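{- In the generic framework of the context, let $\delta$ be an ordinal such that $P_\delta$ holds. For all $s,t\in\mathcal D^\infty$, if $s\twoheadrightarrow_\delta t$ then there exists $s'\in\mathcal D^\infty$ such that $s\to^*s'\,\overline{\twoheadrightarrow}_\delta\,t$.
   Context: Fix a set $\mathcal S$ of statements. A derivation rule $r$ consists of an arity $k\in\mathbb N$, a partial function $r:\mathcal S^k\rightharpoonup\mathcal S$ and a map $c_r:\{1,\dots,k\}\to\{0,1\}$ (premiss $i$ coinductive iff $c_r(i)=1$). Fix a family $\mathcal D$ of derivation rules; $\mathcal D^\infty$ is the set of possibly infinite derivation trees built with rules of $\mathcal D$ in which every infinite branch passes through infinitely many coinductive premisses; $r(s_1,\dots,s_k)$ is the tree with last rule $r$ and immediate subtrees $s_i$. Given zero steps $\to_0\subseteq\mathcal D^\infty\times\mathcal D^\infty$, $\to$ is the closure: $s\to_0t$ implies $s\to t$, and $s_i\to s_i'$ implies $r(\dots,s_i,\dots)\to r(\dots,s_i',\dots)$; $\to^*$ is its reflexive transitive closure. For every ordinal $\gamma$ (by well-founded induction), relations $\twoheadrightarrow_\gamma$, $\overline{\twoheadrightarrow}_\gamma$ are defined by: (split) $s\twoheadrightarrow_\gamma t$ if there are $m\in\mathbb N$, $s'$ with $s\rightsquigarrow^\gamma_ms'$ and $s'\,\overline{\twoheadrightarrow}_\gamma\,t$, where $s\rightsquigarrow^\gamma_ms'$ means there are ordinals $\delta_1,\dots,\delta_m<\gamma$ and trees with $s\to^*s_1'\,\overline{\twoheadrightarrow}_{\delta_1}\,t_1\to^*\cdots\overline{\twoheadrightarrow}_{\delta_m}\,t_m\to^*s'$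 (for $m=0$: $s\to^*s'$); (lift$_r$) $r(s_1,\dots,s_k)\,\overline{\twoheadrightarrow}_\gamma\,r(s_1',\dots,s_k')$ if $s_i\twoheadrightarrow_\gamma s_i'$ for all $i$, premiss $i$ coinductive iff $c_r(i)=1$; derivations may be non-wellfounded provided every infinite branch crosses infinitely many coinductive premisses. Property $P_\delta$: for all $n\in\mathbb N$ and $s,s'\in\mathcal D^\infty$, if $s\rightsquigarrow^\delta_ns'$ then there are $s''\in\mathcal D^\infty$ and $\epsilon<\delta$ with $s\to^*s''$ and $s''\,(\overline{\twoheadrightarrow}_\epsilon)^*\,s'$, where $(\cdot)^*$ denotes reflexive transitive closure. -}

module Defs where

open import Level using (Level; _⊔_) renaming (suc to lsuc; zero to lzero)
open import Data.Nat using (ℕ; zero; suc; _≤_; _<_)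
open import Data.Fin using (Fin; toℕ; fromℕ<)
open import Data.Bool using (Bool; true; false)
open import Data.Maybe using (Maybe; just; nothing)
open import Data.List using (List; []; _∷_; _++_; [_]; tabulate)
open import Data.Product using (Σ; Σ-syntax; ∃; ∃-syntax; _×_; _,_)
open import Relation.Binary.PropositionalEquality using (_≡_; _≢_)
open import Relation.Binary.Structures using (IsStrictTotalOrder)
open import Induction.WellFounded using (WellFounded)

-- A rule r has an
-- arity k = arity r, a partial function S^k ⇀ S (apply r) and a marking
-- coind r : {1..k} → {0,1}  (true = coinductive premiss).

record Framework : Set₁ where
  field
    Stmt  : Set
    Rule  : Set
    arity : Rule → ℕ
    apply : (r : Rule) → (Fin (arity r) → Stmt) → Maybe Stmt
    coind : (r : Rule) → Fin (arity r) → Bool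

-- Ordinals: an arbitrary well-ordered type (a well-founded strict total
-- order).  The lemma for δ only involves ordinals ≤ δ, which form such
-- an order; conversely every well-order is isomorphic to an ordinal.

record Ordinals : Set₁ where
  field
    Ord                : Set
    _<ₒ_               : Ord → Ord → Set
    isStrictTotalOrder : IsStrictTotalOrder _≡_ _<ₒ_
    wellFounded        : WellFounded _<ₒ_

-- Possibly infinite derivation trees, encoded as labelled trees given by
-- their positions: a position is a path from the root (a list of child
-- indices, first step first); each node carries its rule and conclusion.

module Trees (F : Framework) where
  open Framework F

  Pos : Set
  Pos = List ℕ

  RawTree : Set
  RawTree = Pos → Maybe (Rule × Stmt)

  _≗ₜ_ : RawTree → RawTree → Set
  s ≗ₜ t = ∀ p → s p ≡ t p

  path : (ℕ → ℕ) → ℕ → Pos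
  path f n = tabulate {n = n} (λ i → f (toℕ i))

  CoindEdge : RawTree → (ℕ → ℕ) → ℕ → Set
  CoindEdge t f m =
    ∃[ r ] ∃[ a ] Σ (f m < arity r) λ lt →
      (t (path f m) ≡ just (r , a)) × (coind r (fromℕ< lt) ≡ true)

  -- t ∈ D^∞ : a (possibly infinite) derivation tree built with rules of D
  -- in which every infinite branch passes through infinitely many
  -- coinductive premisses
  record IsDerivation (t : RawTree) : Set where
    field
      root     : ∃[ x ] t [] ≡ just x
      closed   : ∀ p i → t p ≡ nothing → t (p ++ [ i ]) ≡ nothing
      local    : ∀ p r a → t p ≡ just (r , a) →
                 ∃[ as ] ( (apply r as ≡ just a)
                         × (∀ (i : Fin (arity r)) → ∃[ r' ] t (p ++ [ toℕ i ]) ≡ just (r' , as i))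
                         × (∀ j → arity r ≤ j → t (p ++ [ j ]) ≡ nothing) )
      branches : ∀ (f : ℕ → ℕ) → (∀ n → ∃[ x ] t (path f n) ≡ just x) →
                 ∀ n → ∃[ m ] (n ≤ m × CoindEdge t f m)

  sub : RawTree → ℕ → RawTree
  sub t i p = t (i ∷ p)

  data Star≗ {ℓ : Level} (R : RawTree → RawTree → Set ℓ) : RawTree → RawTree → Set ℓ where
    ε≗  : ∀ {s t} → s ≗ₜ t → Star≗ R s t
    _◅_ : ∀ {s u t} → R s u → Star≗ R u t → Star≗ R s t

  record ZeroSteps : Set₁ where
    field
      _→₀_    : RawTree → RawTree → Set
      inD∞    : ∀ {s t} → s →₀ t → IsDerivation s × IsDerivation t
      respect : ∀ {s s' t t'} → s ≗ₜ s' → t ≗ₜ t' → s →₀ t → s' →₀ t'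

module Theory (F : Framework) (O : Ordinals) (Z : Trees.ZeroSteps F) where
  open Framework F
  open Ordinals O
  open Trees F
  open ZeroSteps Z

  data _⟶_ : RawTree → RawTree → Set where
    zero-step : ∀ {s t} → s →₀ t → s ⟶ t
    ctx : ∀ {s t} (r : Rule) {a a' : Stmt} →
          IsDerivation s → IsDerivation t →
          s [] ≡ just (r , a) → t [] ≡ just (r , a') →
          (i : Fin (arity r)) →
          (∀ (j : Fin (arity r)) → j ≢ i → sub s (toℕ j) ≗ₜ sub t (toℕ j)) →
          sub s (toℕ i) ⟶ sub t (toℕ i) →
          s ⟶ t

  _⟶*_ : RawTree → RawTree → Set
  _⟶*_ = Star≗ _⟶_

  -- One level of the definition of ↠̄_γ, ↠_γ, ⇝^γ_m, relative to a family
  -- R γ standing for the (coinductive) relations ↠̄_γ.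
  module _ {ℓ : Level} (R : Ord → RawTree → RawTree → Set ℓ) where

    data ChainI (γ : Ord) : ℕ → RawTree → RawTree → Set ℓ where
      done : ∀ {s s'} → s ⟶* s' → ChainI γ zero s s'
      step : ∀ {m s x y s'} (δ : Ord) → δ <ₒ γ →
             s ⟶* x → R δ x y → ChainI γ m y s' → ChainI γ (suc m) s s'

    mutual
      -- rule lift_r (inductive part of the mixed νμ-derivations)
      data LiftI (γ : Ord) : RawTree → RawTree → Set ℓ where
        lift : ∀ {s t} (r : Rule) {a a' : Stmt} →
               IsDerivation s → IsDerivation t →
               s [] ≡ just (r , a) → t [] ≡ just (r , a') →
               (∀ (i : Fin (arity r)) →
                  PremI γ (coind r i) (sub s (toℕ i)) (sub t (toℕ i))) →
               LiftI γ s t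

      -- premiss s_i ↠_γ s_i' of lift_r (rule split); for a coinductive
      -- premiss the ↠̄_γ-subderivation is a coinductive one (R γ)
      data PremI (γ : Ord) : Bool → RawTree → RawTree → Set ℓ where
        indP : ∀ {s t} (m : ℕ) (s' : RawTree) →
               ChainI γ m s s' → LiftI γ s' t → PremI γ false s t
        coiP : ∀ {s t} (m : ℕ) (s' : RawTree) →
               ChainI γ m s s' → R γ s' t → PremI γ true s t

  -- s ↠̄_γ t : greatest fixed point (a post-fixed point R containing (s,t))
  _↠̄⟨_⟩_ : RawTree → Ord → RawTree → Set₁
  s ↠̄⟨ γ ⟩ t =
    Σ[ R ∈ (Ord → RawTree → RawTree → Set) ]
      ((∀ γ' u v → R γ' u v → LiftI R γ' u v) × R γ s t)

  Lift : Ord → RawTree → RawTree → Set₁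
  Lift γ s t = s ↠̄⟨ γ ⟩ t

  _⇝⟨_,_⟩_ : RawTree → Ord → ℕ → RawTree → Set₁
  s ⇝⟨ γ , m ⟩ s' = ChainI Lift γ m s s'

  _↠⟨_⟩_ : RawTree → Ord → RawTree → Set₁
  s ↠⟨ γ ⟩ t = ∃[ m ] ∃[ s' ] (s ⇝⟨ γ , m ⟩ s' × s' ↠̄⟨ γ ⟩ t)

  P : Ord → Set₁
  P δ = ∀ (n : ℕ) (s s' : RawTree) → IsDerivation s → IsDerivation s' →
        s ⇝⟨ δ , n ⟩ s' →
        ∃[ s'' ] (IsDerivation s'' × ∃[ ε ] (ε <ₒ δ × s ⟶* s'' × Star≗ (Lift ε) s'' s'))

-- The ⇝^δ-prefix of s ↠_δ t is handled by P_δ: it becomes s →* s'' followed by a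
-- finite ↠̄_ε-sequence with ε < δ, ending at the source of the ↠̄_δ-part.  It remains
-- to absorb each ↠̄_ε-step into the ↠̄_δ-derivation that follows it.  Both use the
-- rule lift_r of the root of the middle tree, so their premisses can be paired; the
-- ↠̄_ε-derivation of a premiss is a legal extra step of the ⇝^δ-chain of the matching
-- ↠̄_δ-premiss, because ε < δ.  The composite is again a post-fixed point, hence a
-- ↠̄_δ-derivation.
module Submission where

open import Defs
open import Data.Product using (∃-syntax; _×_; _,_; proj₁; proj₂)
open import Data.Sum using (_⊎_; inj₁; inj₂)
open import Data.Nat using (suc; _+_)
open import Data.Maybe using (just)
open import Data.Fin using (toℕ)
open import Data.List using ([])
open import Function using (id)
open import Relation.Binary.PropositionalEquality using (_≡_; refl; sym; trans)
open import Relation.Binary.Structures using (IsStrictTotalOrder)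

module _ {F : Framework} where
  open Trees F

  IsDerivation-resp : ∀ {s t} → s ≗ₜ t → IsDerivation s → IsDerivation t
  IsDerivation-resp {s} {t} s≗t d = record
    { root     = proj₁ (root d) , trans (sym (s≗t [])) (proj₂ (root d))
    ; closed   = λ p i tp≡∅ → trans (sym (s≗t _)) (closed d p i (trans (s≗t p) tp≡∅))
    ; local    = local′
    ; branches = branches′
    }
    where
    open IsDerivation

    local′ : ∀ p r a → t p ≡ just (r , a) → _
    local′ p r a tp≡ with local d p r a (trans (s≗t p) tp≡)
    ... | as , applies , children , beyond =
      as , applies , (λ i → proj₁ (children i) , trans (sym (s≗t _)) (proj₂ (children i)))
         , (λ j k≤j → trans (sym (s≗t _)) (beyond j k≤j))

    branches′ : ∀ f → (∀ n → ∃[ x ] t (path f n) ≡ just x) → _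
    branches′ f infinite n
      with branches d f (λ k → proj₁ (infinite k) , trans (s≗t _) (proj₂ (infinite k))) n
    ... | m , n≤m , r , a , lt , sm≡ , c = m , n≤m , r , a , lt , trans (sym (s≗t _)) sm≡ , c

module _ {F : Framework} {O : Ordinals} {Z : Trees.ZeroSteps F} where
  open Framework F
  open Ordinals O
  open Trees F
  open ZeroSteps Z
  open Theory F O Z

  private
    Rel : Set₁
    Rel = Ord → RawTree → RawTree → Set

    <ₒ-trans : ∀ {a b c} → a <ₒ b → b <ₒ c → a <ₒ c
    <ₒ-trans = IsStrictTotalOrder.trans isStrictTotalOrder

    ≗ₜ-sym : ∀ {s t} → s ≗ₜ t → t ≗ₜ s
    ≗ₜ-sym s≗t p = sym (s≗t p)

  ⟶-respˡ : ∀ {s s' u} → s ≗ₜ s' → s' ⟶ u → s ⟶ u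
  ⟶-respˡ s≗s' (zero-step z) = zero-step (respect (≗ₜ-sym s≗s') (λ _ → refl) z)
  ⟶-respˡ s≗s' (ctx r ds du eqs equ i others sub⟶) =
    ctx r (IsDerivation-resp (≗ₜ-sym s≗s') ds) du (trans (s≗s' []) eqs) equ i
        (λ j j≢i p → trans (s≗s' _) (others j j≢i p)) (⟶-respˡ (λ _ → s≗s' _) sub⟶)

  ⟶*-respˡ : ∀ {s s' u} → s ≗ₜ s' → s' ⟶* u → s ⟶* u
  ⟶*-respˡ s≗s' (ε≗ s'≗u) = ε≗ (λ p → trans (s≗s' p) (s'≗u p))
  ⟶*-respˡ s≗s' (s'⟶ ◅ steps) = ⟶-respˡ s≗s' s'⟶ ◅ steps

  ChainI-respˡ : ∀ {R : Rel} {γ m x x' y} → x ≗ₜ x' → ChainI R γ m x' y → ChainI R γ m x y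
  ChainI-respˡ x≗x' (done steps) = done (⟶*-respˡ x≗x' steps)
  ChainI-respˡ x≗x' (step δ lt steps r c) = step δ lt (⟶*-respˡ x≗x' steps) r c

  PremI-respˡ : ∀ {R : Rel} {γ b x x' y} → x ≗ₜ x' → PremI R γ b x' y → PremI R γ b x y
  PremI-respˡ x≗x' (indP m s' c l) = indP m s' (ChainI-respˡ x≗x' c) l
  PremI-respˡ x≗x' (coiP m s' c r) = coiP m s' (ChainI-respˡ x≗x' c) r

  ChainI-++ : ∀ {R : Rel} {γ m m' x y z w ε} →
              ChainI R γ m x y → ε <ₒ γ → R ε y z → ChainI R γ m' z w →
              ChainI R γ (suc (m + m')) x w
  ChainI-++ (done steps) ε<γ r c = step _ ε<γ steps r c
  ChainI-++ (step δ lt steps r c) ε<γ r' c' = step δ lt steps r (ChainI-++ c ε<γ r' c')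

  module _ {R R' : Rel} (R⊆R' : ∀ {γ x y} → R γ x y → R' γ x y) where

    ChainI-map : ∀ {γ γ' m x y} → (∀ {δ} → δ <ₒ γ → δ <ₒ γ') →
                 ChainI R γ m x y → ChainI R' γ' m x y
    ChainI-map _    (done steps)          = done steps
    ChainI-map γ≤γ' (step δ lt steps r c) = step δ (γ≤γ' lt) steps (R⊆R' r) (ChainI-map γ≤γ' c)

    mutual
      LiftI-map : ∀ {γ x y} → LiftI R γ x y → LiftI R' γ x y
      LiftI-map (lift r dx dy ex ey prems) = lift r dx dy ex ey (λ i → PremI-map (prems i))

      PremI-map : ∀ {γ b x y} → PremI R γ b x y → PremI R' γ b x y
      PremI-map (indP m s' c l) = indP m s' (ChainI-map id c) (LiftI-map l)
      PremI-map (coiP m s' c r) = coiP m s' (ChainI-map id c) (R⊆R' r)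

  ↠̄-isDerivationˡ : ∀ {γ s t} → s ↠̄⟨ γ ⟩ t → IsDerivation s
  ↠̄-isDerivationˡ (R , post , r) with post _ _ _ r
  ... | lift _ ds _ _ _ _ = ds

  ↠̄-respˡ : ∀ {δ u w t} → u ≗ₜ w → w ↠̄⟨ δ ⟩ t → u ↠̄⟨ δ ⟩ t
  ↠̄-respˡ {δ} {u} {w} {t} u≗w (R , post , r) = R' , post' , inj₂ (refl , refl , refl)
    where
    R' : Rel
    R' γ x y = R γ x y ⊎ (γ ≡ δ × x ≡ u × y ≡ t)

    post' : ∀ γ x y → R' γ x y → LiftI R' γ x y
    post' γ x y (inj₁ q) = LiftI-map inj₁ (post γ x y q)
    post' γ x y (inj₂ (refl , refl , refl)) with post δ w t r
    ... | lift r' dw dt ew et prems =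
      lift r' (IsDerivation-resp (≗ₜ-sym u≗w) dw) dt (trans (u≗w []) ew) et
           (λ i → PremI-respˡ (λ _ → u≗w _) (PremI-map inj₁ (prems i)))

  ↠̄-trans : ∀ {ε δ u v t} → ε <ₒ δ → u ↠̄⟨ ε ⟩ v → v ↠̄⟨ δ ⟩ t → u ↠̄⟨ δ ⟩ t
  ↠̄-trans {ε} {δ} {u} {v} {t} ε<δ (R₁ , post₁ , r₁) (R₂ , post₂ , r₂) =
    R' , post' , inj₂ (inj₂ (refl , refl , refl))
    where
    -- The first summand holds the unfolded ↠̄_ε-steps that become chain steps of ⇝^δ.
    R' : Rel
    R' γ x y = LiftI R₁ γ x y ⊎ (R₂ γ x y ⊎ (γ ≡ δ × x ≡ u × y ≡ t))

    R₁⊆R' : ∀ {γ x y} → R₁ γ x y → R' γ x y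
    R₁⊆R' q = inj₁ (post₁ _ _ _ q)

    R₂⊆R' : ∀ {γ x y} → R₂ γ x y → R' γ x y
    R₂⊆R' q = inj₂ (inj₁ q)

    through-ε : ∀ {m m' x y z w} → ChainI R₁ ε m x y → LiftI R₁ ε y z →
                ChainI R₂ δ m' z w → ChainI R' δ (suc (m + m')) x w
    through-ε c₁ l c₂ =
      ChainI-++ (ChainI-map R₁⊆R' (λ d<ε → <ₒ-trans d<ε ε<δ) c₁) ε<δ (inj₁ l)
                (ChainI-map R₂⊆R' id c₂)

    PremI-trans : ∀ {b x y z} → PremI R₁ ε b x y → PremI R₂ δ b y z → PremI R' δ b x z
    PremI-trans (indP _ _ c₁ l₁) (indP _ y' c₂ l₂) =
      indP _ y' (through-ε c₁ l₁ c₂) (LiftI-map R₂⊆R' l₂)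
    PremI-trans (coiP _ _ c₁ q₁) (coiP _ y' c₂ q₂) =
      coiP _ y' (through-ε c₁ (post₁ _ _ _ q₁) c₂) (R₂⊆R' q₂)

    zip-lift : ∀ {r r' a a' au at} → just (r , a) ≡ just (r' , a') →
               IsDerivation u → IsDerivation t → u [] ≡ just (r , au) → t [] ≡ just (r' , at) →
               (∀ i → PremI R₁ ε (coind r i) (sub u (toℕ i)) (sub v (toℕ i))) →
               (∀ i → PremI R₂ δ (coind r' i) (sub v (toℕ i)) (sub t (toℕ i))) →
               LiftI R' δ u t
    zip-lift refl du dt eu et prems₁ prems₂ =
      lift _ du dt eu et (λ i → PremI-trans (prems₁ i) (prems₂ i))

    post' : ∀ γ x y → R' γ x y → LiftI R' γ x y
    post' γ x y (inj₁ l) = LiftI-map R₁⊆R' l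
    post' γ x y (inj₂ (inj₁ q)) = LiftI-map R₂⊆R' (post₂ γ x y q)
    post' γ x y (inj₂ (inj₂ (refl , refl , refl))) with post₁ ε u v r₁ | post₂ δ v t r₂
    ... | lift _ du _ eu ev prems₁ | lift _ _ dt ev' et prems₂ =
      zip-lift (trans (sym ev) ev') du dt eu et prems₁ prems₂

  ↠̄-trans-star : ∀ {ε δ u w t} → ε <ₒ δ → Star≗ (Lift ε) u w → w ↠̄⟨ δ ⟩ t → u ↠̄⟨ δ ⟩ t
  ↠̄-trans-star ε<δ (ε≗ u≗w)     w↠̄t = ↠̄-respˡ u≗w w↠̄t
  ↠̄-trans-star ε<δ (u↠̄v ◅ v↠̄*w) w↠̄t = ↠̄-trans ε<δ u↠̄v (↠̄-trans-star ε<δ v↠̄*w w↠̄t)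

lemma3p6 : (F : Framework) (O : Ordinals) (Z : Trees.ZeroSteps F)
           (δ : Ordinals.Ord O) →
           Theory.P F O Z δ →
           ∀ (s t : Trees.RawTree F) →
           Trees.IsDerivation F s → Trees.IsDerivation F t →
           Theory._↠⟨_⟩_ F O Z s δ t →
           ∃[ s' ] (Trees.IsDerivation F s' ×
                    Theory._⟶*_ F O Z s s' × Theory._↠̄⟨_⟩_ F O Z s' δ t)
lemma3p6 F O Z δ Pδ s t ds _ (m , s' , s⇝s' , s'↠̄t)
  with Pδ m s s' ds (↠̄-isDerivationˡ s'↠̄t) s⇝s'
... | s'' , ds'' , ε , ε<δ , s⟶*s'' , s''↠̄*s' =
  s'' , ds'' , s⟶*s'' , ↠̄-trans-star ε<δ s''↠̄*s' s'↠̄t
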